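{- Let $\Phi$ be a Q3SAT formula and $\Gamma_\Phi$ the CSTN constructed from it. If $\Phi$ is false, then $\Gamma_\Phi$ is not dynamically controllable.
   Context: CSTN notions: a label over a finite set $\mathcal P$ of propositional variables is a conjunction of literals on distinct variables; the empty label $\lambda$ is always true. A scenario is $s:\mathcal P\to\{0,1\}$; $s\vDash\ell$ means $\ell$ true under $s$. A CSTN is $\Gamma=(\mathcal T,\mathcal P,\mathcal C,\mathcal L,\mathcal{OT},\mathcal O)$ with $\mathcal T$ a finite set of tasks, $\mathcal C$ a finite set of labeled constraints $(Y-X\le\delta,\ell)$, $\mathcal L$ a label on each task, $\mathcal{OT}\subseteq\mathcal T$, $\mathcal O:\mathcal P\to\mathcal{OT}$ a bijection. For a scenario $s$, $\mathcal T_s=\{X:s\vDash\mathcal L(X)\}$ and $\mathcal C_s$ is the set of constraints $Y-X\le\delta$ whose label holds in $s$. An execution strategy $\sigma$ maps each scenario $s$ to $\sigma(s):\mathcal T_s\to\mathbb R$ (write $[\sigma(s)]_X$); it is viable if each $\sigma(s)$ satisfies all constraints of $\mathcal C_s$. $\mathrm{Hist}(t,s,\sigma)$ is the restriction of $s$ to $\{p:[\sigma(s)]_{\mathcal O(p)}<t\}$. $\sigma$ is dynamic if for all $s,s'$ and $X\in\mathcal T_s$, with $t=[\sigma(s)]_X$, $\mathrm{Hist}(t,s,\sigma)=\mathrm{Hist}(t,s',\sigma)$ implies $X\in\mathcal T_{s'}$ and $[\sigma(s')]_X=t$. $\Gamma$ is dynamically controllable if it has a dynamic viable execution strategy. Construction: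 $\Phi=\exists x_1\forall y_1\cdots\exists x_n\forall y_n\,\varphi$ with $\varphi=\bigwedge_{j=1}^m(l_{j,1}\vee l_{j,2}\vee l_{j,3})$, each literal a positive or negated occurrence of one of $x_1,y_1,\dots,x_n,y_n$; $\Phi$ is true/false according to the truth value of this quantified boolean formula. $\Gamma_\Phi$ has tasks $A_i,B_i,C_i^0,C_i^1,D_i,X_i,Y_i$ ($i=1,\dots,n$) and $A_{n+1},B_{n+1}$; propositional variables $x_i,y_i,c_i^0,c_i^1$; all task labels empty; $\mathcal O(x_i)=X_i$, $\mathcal O(y_i)=Y_i$, $\mathcal O(c_i^0)=C_i^0$, $\mathcal O(c_i^1)=C_i^1$; constraints: $(B_1-A_1\le0,\lambda)$; for $i=1,\dots,n$: $(D_i\le B_i+1,\ c_i^0\wedge c_i^1)$, $(D_i\ge A_i+(n+2),\ \neg c_i^0\wedge\neg c_i^1)$, $(X_i\ge A_i+(n+2),\lambda)$, $(Y_i\ge X_i+1,\lambda)$, $(A_{i+1}\ge Y_i+1,\lambda)$, $(B_{i+1}\le C_i^0+(n+4),\ \neg x_i)$, $(B_{i+1}\le C_i^1+(n+4),\ x_i)$; for $j=1,\dots,m$: $(B_{n+1}-A_{n+1}\ge n+1,\ \neg l_{j,1}\wedge\neg l_{j,2}\wedge\neg l_{j,3})$. -}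

module Defs where

open import Data.Nat using (ℕ; zero; suc)
open import Data.Bool using (Bool; true; false; _∧_; _∨_; not; if_then_else_)
open import Data.Fin using (Fin; inject₁; fromℕ) renaming (zero to fzero; suc to fsuc)
open import Data.Vec.Functional using () renaming (_∷_ to _∷ᶠ_; [] to []ᶠ)
open import Data.List using (List; []; _∷_; _++_; map; concatMap; allFin; foldr)
open import Data.List.Relation.Unary.All using (All)
open import Data.List.Membership.Propositional using (_∈_)
open import Data.Product using (Σ; ∃; _×_; _,_)
open import Data.Sum using (_⊎_)
open import Relation.Nullary using (¬_)
open import Relation.Binary.PropositionalEquality using (_≡_; _≢_)
open import Algebra.Structures using (IsCommutativeRing)
open import Relation.Binary.Structures using (IsTotalOrder)

record RealField : Set₁ where
  infixl 6 _+_ _-_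
  infixl 7 _*_
  infix  4 _≤_ _<_
  field
    Carrier : Set
    _+_ _*_ : Carrier → Carrier → Carrier
    -_      : Carrier → Carrier
    0# 1#   : Carrier
    _≤_     : Carrier → Carrier → Set
    isCommutativeRing : IsCommutativeRing _≡_ _+_ _*_ -_ 0# 1#
    0≢1     : 0# ≢ 1#
    inverse : ∀ x → x ≢ 0# → Σ Carrier λ y → x * y ≡ 1#
    isTotalOrder : IsTotalOrder _≡_ _≤_
    +-mono-≤ : ∀ {x y} z → x ≤ y → x + z ≤ y + z
    *-nonneg : ∀ {x y} → 0# ≤ x → 0# ≤ y → 0# ≤ x * y
    complete : (S : Carrier → Set) → Σ Carrier S →
               Σ Carrier (λ b → ∀ x → S x → x ≤ b) →
               Σ Carrier (λ u → (∀ x → S x → x ≤ u) ×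
                                (∀ b → (∀ x → S x → x ≤ b) → u ≤ b))

  _-_ : Carrier → Carrier → Carrier
  x - y = x + (- y)

  _<_ : Carrier → Carrier → Set
  x < y = (x ≤ y) × (x ≢ y)

  fromℕ# : ℕ → Carrier
  fromℕ# zero    = 0#
  fromℕ# (suc k) = fromℕ# k + 1#

-- A literal on propositional variable p : (p , true) is p, (p , false) is ¬p.
-- A label is a conjunction of literals; [] is the empty label λ.
Label : Set → Set
Label P = List (P × Bool)

Scenario : Set → Set
Scenario P = P → Bool

_⊨_ : {P : Set} → Scenario P → Label P → Set
s ⊨ ℓ = All (λ { (p , b) → s p ≡ b }) ℓ

module _ (R : RealField) where
  open RealField R

  record LConstraint (T P : Set) : Set where
    constructor [_-_≤_,_]
    field
      Y X   : T
      δ     : Carrier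
      label : Label P

  record CSTN : Set₁ where
    field
      Task  : Set
      Prop  : Set
      C     : List (LConstraint Task Prop)
      L     : Task → Label Prop
      -- observation function; OT is its image, so O is a bijection P → OT
      O     : Prop → Task
      O-injective : ∀ {p q} → O p ≡ O q → p ≡ q

  module _ (Γ : CSTN) where
    open CSTN Γ

    InT : Scenario Prop → Task → Set
    InT s X = s ⊨ L X

    -- An execution strategy: σ s is meaningful on T_s (values outside T_s are
    -- never used by the definitions below).
    Strategy : Set
    Strategy = Scenario Prop → Task → Carrier

    Viable : Strategy → Set
    Viable σ = ∀ s c → c ∈ C → s ⊨ LConstraint.label c →
      InT s (LConstraint.Y c) × InT s (LConstraint.X c) ×
      (σ s (LConstraint.Y c) - σ s (LConstraint.X c) ≤ LConstraint.δ c)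

    InHist : Carrier → Scenario Prop → Strategy → Prop → Set
    InHist t s σ p = InT s (O p) × (σ s (O p) < t)

    -- Hist(t,s,σ) = Hist(t,s',σ)  (equality of partial functions)
    HistEq : Carrier → Scenario Prop → Scenario Prop → Strategy → Set
    HistEq t s s' σ = ∀ p →
      (InHist t s σ p → InHist t s' σ p) ×
      (InHist t s' σ p → InHist t s σ p) ×
      (InHist t s σ p → s p ≡ s' p)

    Dynamic : Strategy → Set
    Dynamic σ = ∀ s s' X → InT s X → HistEq (σ s X) s s' σ →
      InT s' X × (σ s' X ≡ σ s X)

    DynamicallyControllable : Set
    DynamicallyControllable = Σ Strategy λ σ → Viable σ × Dynamic σ

-- Q3SAT formulas  ∃x₁∀y₁ ⋯ ∃xₙ∀yₙ φ   (index i : Fin n stands for i+1)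

data QVar (n : ℕ) : Set where
  xv yv : Fin n → QVar n

record Lit (n : ℕ) : Set where
  constructor lit
  field
    var : QVar n
    pos : Bool

record Q3SAT : Set where
  field
    n m    : ℕ
    clause : Fin m → Lit n × Lit n × Lit n

litVal : {n : ℕ} → (Fin n → Bool) → (Fin n → Bool) → Lit n → Bool
litVal ax ay (lit (xv i) b) = if b then ax i else not (ax i)
litVal ax ay (lit (yv i) b) = if b then ay i else not (ay i)

matrix : (Φ : Q3SAT) → (Fin (Q3SAT.n Φ) → Bool) → (Fin (Q3SAT.n Φ) → Bool) → Bool
matrix Φ ax ay = foldr (λ j b → clauseVal (Q3SAT.clause Φ j) ∧ b) true (allFin (Q3SAT.m Φ))
  where
  clauseVal : _ → Bool
  clauseVal (l₁ , l₂ , l₃) = litVal ax ay l₁ ∨ litVal ax ay l₂ ∨ litVal ax ay l₃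

QEval : (k : ℕ) → ((Fin k → Bool) → (Fin k → Bool) → Bool) → Bool
QEval zero    f = f []ᶠ []ᶠ
QEval (suc k) f =
  (QEval k (λ ax ay → f (false ∷ᶠ ax) (false ∷ᶠ ay)) ∧ QEval k (λ ax ay → f (false ∷ᶠ ax) (true ∷ᶠ ay)))
  ∨
  (QEval k (λ ax ay → f (true ∷ᶠ ax) (false ∷ᶠ ay)) ∧ QEval k (λ ax ay → f (true ∷ᶠ ax) (true ∷ᶠ ay)))

truth : Q3SAT → Bool
truth Φ = QEval (Q3SAT.n Φ) (matrix Φ)

-- The CSTN Γ_Φ.   A i, B i : i : Fin (n+1) stands for A_{i+1}, B_{i+1}.

data ΓTask (n : ℕ) : Set where
  A B           : Fin (suc n) → ΓTask n
  C0 C1 D X Y   : Fin n → ΓTask n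

data ΓProp (n : ℕ) : Set where
  px py pc0 pc1 : Fin n → ΓProp n

ΓO : {n : ℕ} → ΓProp n → ΓTask n
ΓO (px i)  = X i
ΓO (py i)  = Y i
ΓO (pc0 i) = C0 i
ΓO (pc1 i) = C1 i

ΓO-injective : {n : ℕ} {p q : ΓProp n} → ΓO p ≡ ΓO q → p ≡ q
ΓO-injective {p = px i}  {px .i}  _≡_.refl = _≡_.refl
ΓO-injective {p = py i}  {py .i}  _≡_.refl = _≡_.refl
ΓO-injective {p = pc0 i} {pc0 .i} _≡_.refl = _≡_.refl
ΓO-injective {p = pc1 i} {pc1 .i} _≡_.refl = _≡_.refl

negLit : {n : ℕ} → Lit n → ΓProp n × Bool
negLit (lit (xv i) b) = px i , not b
negLit (lit (yv i) b) = py i , not b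

module _ (R : RealField) where
  open RealField R

  ΓConstraints : (Φ : Q3SAT) → List (LConstraint R (ΓTask (Q3SAT.n Φ)) (ΓProp (Q3SAT.n Φ)))
  ΓConstraints Φ =
    [ B fzero - A fzero ≤ 0# , [] ]
    ∷ concatMap perI (allFin n)
    ++ map perJ (allFin m)
    where
    open Q3SAT Φ
    N : ℕ
    N = n
    perI : Fin n → List (LConstraint R (ΓTask n) (ΓProp n))
    perI i =
      [ D i - B (inject₁ i) ≤ 1# , (pc0 i , true) ∷ (pc1 i , true) ∷ [] ]
      ∷ [ A (inject₁ i) - D i ≤ - fromℕ# (suc (suc N)) , (pc0 i , false) ∷ (pc1 i , false) ∷ [] ]
      ∷ [ A (inject₁ i) - X i ≤ - fromℕ# (suc (suc N)) , [] ]
      ∷ [ X i - Y i ≤ - 1# , [] ]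
      ∷ [ Y i - A (fsuc i) ≤ - 1# , [] ]
      ∷ [ B (fsuc i) - C0 i ≤ fromℕ# (suc (suc (suc (suc N)))) , (px i , false) ∷ [] ]
      ∷ [ B (fsuc i) - C1 i ≤ fromℕ# (suc (suc (suc (suc N)))) , (px i , true) ∷ [] ]
      ∷ []
    perJ : Fin m → LConstraint R (ΓTask n) (ΓProp n)
    perJ j with clause j
    ... | (l₁ , l₂ , l₃) =
      [ A (fromℕ n) - B (fromℕ n) ≤ - fromℕ# (suc N) , negLit l₁ ∷ negLit l₂ ∷ negLit l₃ ∷ [] ]

  Γ : Q3SAT → CSTN R
  Γ Φ = record
    { Task = ΓTask (Q3SAT.n Φ)
    ; Prop = ΓProp (Q3SAT.n Φ)
    ; C    = ΓConstraints Φ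
    ; L    = λ _ → []
    ; O    = ΓO
    ; O-injective = ΓO-injective
    }

-- Suppose σ were a dynamic viable strategy for Γ_Φ. In the scenario where every c_i holds, the
-- two constraints on D_i pull it both near B_i and, as soon as neither C_i^0 nor C_i^1 precedes it,
-- far beyond A_i; so σ must schedule some C_i^b before D_i, and that b, which σ fixes before it
-- observes x_i and which depends only on earlier observations, is an existential strategy for Φ.
-- Since Φ is false, a universal counter-strategy produces a play falsifying some clause. Along
-- that play the gap B_i − A_i grows by at most 1 per round, so B_{n+1} ≤ A_{n+1} + n, contradicting
-- the constraint B_{n+1} − A_{n+1} ≥ n + 1 labelled by the falsified clause.
module Submission where

open import Defs
open import Level using (0ℓ)
open import Function using (_∘_)
open import Data.Bool using (Bool; true; false; _∧_; _∨_; if_then_else_)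
open import Data.Bool.Properties using (not-injective)
open import Data.Nat as ℕ using (ℕ; zero; suc)
import Data.Nat.Properties as ℕ
open import Data.Fin as F using (Fin; inject₁; fromℕ; toℕ; #_) renaming (zero to fzero; suc to fsuc)
open import Data.Fin.Properties using (toℕ-inject₁; toℕ-fromℕ; toℕ<n; <-cmp)
open import Data.Fin.Induction using (<-weakInduction; <-weakInduction-startingFrom)
open import Data.Vec.Functional using () renaming (_∷_ to _∷ᶠ_; [] to []ᶠ)
open import Data.List using (List; []; _∷_; _++_; concatMap; allFin; foldr; cartesianProduct)
open import Data.List.Relation.Unary.All using ([]; _∷_)
import Data.List.Relation.Unary.Any as Any
open Any using (here; there)
open import Data.List.Membership.Propositional using (_∈_)
open import Data.List.Membership.Propositional.Properties
  using (∈-++⁺ˡ; ∈-++⁺ʳ; ∈-map⁺; ∈-allFin; ∈-concatMap⁺; ∈-cartesianProduct⁺; ∈-lookup)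
open import Data.Empty using (⊥-elim)
open import Data.Sum using (_⊎_; inj₁; inj₂)
open import Data.Product using (∃; ∃₂; _×_; _,_; proj₁; proj₂)
open import Relation.Nullary using (¬_; does)
open import Relation.Nullary.Negation using (¬¬-Monad; ¬¬-map)
open import Relation.Nullary.Decidable using (Dec; ¬¬-excluded-middle; yes; no; dec-true)
open import Relation.Binary using (tri<; tri≈; tri>)
open import Relation.Binary.Bundles using (TotalOrder; TotalPreorder)
open import Relation.Binary.PropositionalEquality
open import Algebra.Bundles using (CommutativeRing)
open import Effect.Monad using (RawMonad)
import Relation.Binary.Reasoning.PartialOrder as PartialOrderReasoning

-- The order on the reals is not decidable, so case distinctions on it are made in the
-- double-negation monad; that costs nothing, since the theorem is a negation.
open RawMonad (¬¬-Monad {0ℓ})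

module OrderedFieldProperties (R : RealField) where
  open RealField R

  totalOrder : TotalOrder 0ℓ 0ℓ 0ℓ
  totalOrder = record { isTotalOrder = isTotalOrder }

  commutativeRing : CommutativeRing 0ℓ 0ℓ
  commutativeRing = record { isCommutativeRing = isCommutativeRing }

  open TotalOrder totalOrder public
    using (total; antisym; totalPreorder) renaming (refl to ≤-refl; trans to ≤-trans)
  open import Relation.Binary.Properties.TotalOrder totalOrder public
    using (<⇒≱; <-irrefl; <-trans)
  open CommutativeRing commutativeRing using (+-comm; +-assoc; +-identityʳ; +-identityˡ; -‿inverseʳ)
  open import Algebra.Properties.Group (CommutativeRing.+-group commutativeRing)
    using (//-rightDividesˡ; ⁻¹-involutive)
  open import Algebra.Properties.Ring (CommutativeRing.ring commutativeRing) using (-1*x≈-x)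
  module ≤-Reasoning = PartialOrderReasoning (TotalOrder.poset totalOrder)

  <-stable : ∀ {x y} → ¬ ¬ (x < y) → x < y
  <-stable {x} {y} ¬¬x<y with total x y
  ... | inj₁ x≤y = x≤y , λ x≡y → ¬¬x<y (λ x<y → proj₂ x<y x≡y)
  ... | inj₂ y≤x = ⊥-elim (¬¬x<y (λ x<y → <⇒≱ x<y y≤x))

  <-respˡ-¬¬≡ : ∀ {x y v} → x < v → ¬ ¬ (x ≡ y) → y < v
  <-respˡ-¬¬≡ {v = v} x<v ¬¬x≡y = <-stable (¬¬-map (λ x≡y → subst (_< v) x≡y x<v) ¬¬x≡y)

  <-≤-trans : ∀ {x y z} → x < y → y ≤ z → x < z
  <-≤-trans {x} {y} {z} x<y y≤z = begin-strict x <⟨ x<y ⟩ y ≤⟨ y≤z ⟩ z ∎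
    where open ≤-Reasoning

  0≤1 : 0# ≤ 1#
  0≤1 with total 0# 1#
  ... | inj₁ 0≤1 = 0≤1
  ... | inj₂ 1≤0 = subst (0# ≤_) -1*-1≡1 (*-nonneg 0≤-1 0≤-1)
    where
    0≤-1 : 0# ≤ - 1#
    0≤-1 = subst₂ _≤_ (-‿inverseʳ 1#) (+-identityˡ (- 1#)) (+-mono-≤ (- 1#) 1≤0)
    -1*-1≡1 : (- 1#) * (- 1#) ≡ 1#
    -1*-1≡1 = trans (-1*x≈-x (- 1#)) (⁻¹-involutive 1#)

  +-monoʳ-≤ : ∀ {x y} z → x ≤ y → z + x ≤ z + y
  +-monoʳ-≤ {x} {y} z x≤y = subst₂ _≤_ (+-comm x z) (+-comm y z) (+-mono-≤ z x≤y)

  y-x≤δ⇒y≤x+δ : ∀ {x y δ} → y - x ≤ δ → y ≤ x + δ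
  y-x≤δ⇒y≤x+δ {x} {y} {δ} y-x≤δ = subst₂ _≤_ (//-rightDividesˡ x y) (+-comm δ x) (+-mono-≤ x y-x≤δ)

  y-x≤-δ⇒y+δ≤x : ∀ {x y δ} → y - x ≤ - δ → y + δ ≤ x
  y-x≤-δ⇒y+δ≤x {x} {y} {δ} y-x≤-δ =
    subst (y + δ ≤_) (//-rightDividesˡ δ x) (+-mono-≤ δ (y-x≤δ⇒y≤x+δ y-x≤-δ))

  fromℕ#-1 : fromℕ# 1 ≡ 1#
  fromℕ#-1 = +-identityˡ 1#

  fromℕ#-homo-+ : ∀ a b → fromℕ# (a ℕ.+ b) ≡ fromℕ# a + fromℕ# b
  fromℕ#-homo-+ zero    b = sym (+-identityˡ (fromℕ# b))
  fromℕ#-homo-+ (suc a) b = begin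
    fromℕ# (a ℕ.+ b) + 1#          ≡⟨ cong (_+ 1#) (fromℕ#-homo-+ a b) ⟩
    fromℕ# a + fromℕ# b + 1#       ≡⟨ +-assoc (fromℕ# a) (fromℕ# b) 1# ⟩
    fromℕ# a + (fromℕ# b + 1#)     ≡⟨ cong (fromℕ# a +_) (+-comm (fromℕ# b) 1#) ⟩
    fromℕ# a + (1# + fromℕ# b)     ≡⟨ sym (+-assoc (fromℕ# a) 1# (fromℕ# b)) ⟩
    fromℕ# a + 1# + fromℕ# b       ∎
    where open ≡-Reasoning

  0≤fromℕ# : ∀ k → 0# ≤ fromℕ# k
  0≤fromℕ# zero    = ≤-refl
  0≤fromℕ# (suc k) = subst (_≤ fromℕ# (suc k)) (+-identityʳ 0#)
    (≤-trans (+-mono-≤ 0# (0≤fromℕ# k)) (+-monoʳ-≤ (fromℕ# k) 0≤1))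

  0≢fromℕ#-suc : ∀ k → 0# ≢ fromℕ# (suc k)
  0≢fromℕ#-suc k 0≡k+1 = 0≢1 (antisym 0≤1 1≤0)
    where
    1≤0 : 1# ≤ 0#
    1≤0 = subst₂ _≤_ (+-identityˡ 1#) (sym 0≡k+1) (+-mono-≤ 1# (0≤fromℕ# k))

  -- Offsets by natural numbers; all constants of Γ_Φ are of this form.
  infixl 6 _+ℕ_
  _+ℕ_ : Carrier → ℕ → Carrier
  x +ℕ k = x + fromℕ# k

  +ℕ-assoc : ∀ x a b → x +ℕ a +ℕ b ≡ x +ℕ (a ℕ.+ b)
  +ℕ-assoc x a b = trans (+-assoc x (fromℕ# a) (fromℕ# b)) (cong (x +_) (sym (fromℕ#-homo-+ a b)))

  +ℕ-swap : ∀ x a b → x +ℕ a +ℕ b ≡ x +ℕ b +ℕ a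
  +ℕ-swap x a b = begin
    x +ℕ a +ℕ b        ≡⟨ +ℕ-assoc x a b ⟩
    x +ℕ (a ℕ.+ b)     ≡⟨ cong (x +ℕ_) (ℕ.+-comm a b) ⟩
    x +ℕ (b ℕ.+ a)     ≡⟨ sym (+ℕ-assoc x b a) ⟩
    x +ℕ b +ℕ a        ∎
    where open ≡-Reasoning

  +ℕ-suc : ∀ x k → x +ℕ k +ℕ 1 ≡ x +ℕ suc k
  +ℕ-suc x k = trans (+ℕ-assoc x k 1) (cong (x +ℕ_) (ℕ.+-comm k 1))

  +ℕ-monoˡ-≤ : ∀ {x y} k → x ≤ y → x +ℕ k ≤ y +ℕ k
  +ℕ-monoˡ-≤ k = +-mono-≤ (fromℕ# k)

  x≤x+ℕk : ∀ x k → x ≤ x +ℕ k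
  x≤x+ℕk x k = subst (_≤ x +ℕ k) (+-identityʳ x) (+-monoʳ-≤ x (0≤fromℕ# k))

  x<x+ℕ1+k : ∀ x k → x < x +ℕ suc k
  x<x+ℕ1+k x k = x≤x+ℕk x (suc k) , λ x≡x+k+1 → 0≢fromℕ#-suc k (begin
    0#                           ≡⟨ sym (-‿inverseʳ x) ⟩
    x + - x                      ≡⟨ cong (_+ - x) x≡x+k+1 ⟩
    x + fromℕ# (suc k) + - x     ≡⟨ +-assoc x (fromℕ# (suc k)) (- x) ⟩
    x + (fromℕ# (suc k) + - x)   ≡⟨ cong (x +_) (+-comm (fromℕ# (suc k)) (- x)) ⟩
    x + (- x + fromℕ# (suc k))   ≡⟨ sym (+-assoc x (- x) (fromℕ# (suc k))) ⟩
    x + - x + fromℕ# (suc k)     ≡⟨ cong (_+ fromℕ# (suc k)) (-‿inverseʳ x) ⟩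
    0# + fromℕ# (suc k)          ≡⟨ +-identityˡ (fromℕ# (suc k)) ⟩
    fromℕ# (suc k)               ∎)
    where open ≡-Reasoning

  +ℕ-monoʳ-< : ∀ x {a b} → a ℕ.< b → x +ℕ a < x +ℕ b
  +ℕ-monoʳ-< x {a} {b} a<b with ℕ.m≤n⇒∃[o]m+o≡n a<b
  ... | o , 1+a+o≡b = begin-strict
    x +ℕ a                <⟨ x<x+ℕ1+k (x +ℕ a) o ⟩
    x +ℕ a +ℕ suc o       ≡⟨ +ℕ-assoc x a (suc o) ⟩
    x +ℕ (a ℕ.+ suc o)    ≡⟨ cong (x +ℕ_) (trans (ℕ.+-suc a o) 1+a+o≡b) ⟩
    x +ℕ b                ∎
    where open ≤-Reasoning

module _ (P : TotalPreorder 0ℓ 0ℓ 0ℓ) where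
  open TotalPreorder P using (Carrier; _≲_; total) renaming (refl to ≲-refl; trans to ≲-trans)

  NoneOrMinimum : {A : Set} (key : A → Carrier) (Q : A → Set) (xs : List A) → Set
  NoneOrMinimum key Q xs = (∀ x → x ∈ xs → ¬ Q x) ⊎ ∃ λ x → Q x × ∀ y → y ∈ xs → Q y → key x ≲ key y

  ¬¬-none⊎minimum : {A : Set} (key : A → Carrier) (Q : A → Set) (xs : List A) →
    ¬ ¬ NoneOrMinimum key Q xs
  ¬¬-none⊎minimum key Q [] = pure (inj₁ λ _ ())
  ¬¬-none⊎minimum key Q (x ∷ xs) = do
    r ← ¬¬-none⊎minimum key Q xs
    q? ← ¬¬-excluded-middle
    pure (extend r q?)
    where
    extend : NoneOrMinimum key Q xs → Dec (Q x) → NoneOrMinimum key Q (x ∷ xs)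
    extend (inj₁ none) (no ¬q) = inj₁ λ { _ (here refl) → ¬q ; y (there y∈) → none y y∈ }
    extend (inj₁ none) (yes q) =
      inj₂ (x , q , λ { _ (here refl) _ → ≲-refl ; y (there y∈) qy → ⊥-elim (none y y∈ qy) })
    extend (inj₂ (m , qm , min)) (no ¬q) =
      inj₂ (m , qm , λ { _ (here refl) qx → ⊥-elim (¬q qx) ; y (there y∈) qy → min y y∈ qy })
    extend (inj₂ (m , qm , min)) (yes q) with total (key x) (key m)
    ... | inj₁ x≲m =
      inj₂ (x , q , λ { _ (here refl) _ → ≲-refl ; y (there y∈) qy → ≲-trans x≲m (min y y∈ qy) })
    ... | inj₂ m≲x = inj₂ (m , qm , λ { _ (here refl) _ → m≲x ; y (there y∈) qy → min y y∈ qy })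

∈-concatMap-allFin : ∀ {n} {A : Set} {f : Fin n → List A} i {a} → a ∈ f i →
  a ∈ concatMap f (allFin n)
∈-concatMap-allFin {f = f} i a∈fi = ∈-concatMap⁺ f (Any.map (λ { refl → a∈fi }) (∈-allFin i))

foldr-∧-false : ∀ {A : Set} (g : A → Bool) xs → foldr (λ x b → g x ∧ b) true xs ≡ false →
  ∃ λ x → g x ≡ false
foldr-∧-false g (x ∷ xs) e with g x in gx
... | false = x , gx
... | true  = foldr-∧-false g xs e

∨-≡-false : ∀ a b → a ∨ b ≡ false → a ≡ false × b ≡ false
∨-≡-false false b b≡false = refl , b≡false

∧-≡-false : ∀ a b → a ∧ b ≡ false → a ≡ false ⊎ b ≡ false
∧-≡-false false b _        = inj₁ refl
∧-≡-false true  b b≡false = inj₂ b≡false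

QEval-false⇒∀∃-false : ∀ {k} (f : (Fin (suc k) → Bool) → (Fin (suc k) → Bool) → Bool) →
  QEval (suc k) f ≡ false →
  ∀ x₀ → ∃ λ y₀ → QEval k (λ ax ay → f (x₀ ∷ᶠ ax) (y₀ ∷ᶠ ay)) ≡ false
QEval-false⇒∀∃-false f f-false false with ∧-≡-false _ _ (proj₁ (∨-≡-false _ _ f-false))
... | inj₁ e = false , e
... | inj₂ e = true , e
QEval-false⇒∀∃-false f f-false true with ∧-≡-false _ _ (proj₂ (∨-≡-false _ _ f-false))
... | inj₁ e = false , e
... | inj₂ e = true , e

-- An existential strategy for ∃x₁∀y₁⋯∃x_k∀y_k, given as a relation: G ax ay i b says that in the
-- play (ax, ay) the strategy allows the move x_i = b.
module _ {k : ℕ} (G : (Fin k → Bool) → (Fin k → Bool) → Fin k → Bool → Set) where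

  FollowedBelow : (Fin k → Bool) → (Fin k → Bool) → ℕ → Set
  FollowedBelow ax ay l = ∀ j → toℕ j ℕ.< l → G ax ay j (ax j)

  Responsive : Set
  Responsive = ∀ ax ay i → FollowedBelow ax ay (toℕ i) → ¬ ¬ ∃ (G ax ay i)

  Causal : Set
  Causal = ∀ {ax ay ax' ay'} i {b} → FollowedBelow ax ay (toℕ i) →
    (∀ j → toℕ j ℕ.< toℕ i → ax j ≡ ax' j × ay j ≡ ay' j) → G ax ay i b → G ax' ay' i b

followedBelow-mono : ∀ {k G} {ax ay : Fin k → Bool} {l l'} → l ℕ.≤ l' →
  FollowedBelow G ax ay l' → FollowedBelow G ax ay l
followedBelow-mono l≤l' fb j j<l = fb j (ℕ.<-≤-trans j<l l≤l')

shift : ∀ {k} → ((Fin (suc k) → Bool) → (Fin (suc k) → Bool) → Fin (suc k) → Bool → Set) →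
  Bool → Bool → (Fin k → Bool) → (Fin k → Bool) → Fin k → Bool → Set
shift G x₀ y₀ ax ay i = G (x₀ ∷ᶠ ax) (y₀ ∷ᶠ ay) (fsuc i)

module _ {k} {G : (Fin (suc k) → Bool) → (Fin (suc k) → Bool) → Fin (suc k) → Bool → Set}
         {x₀ y₀ : Bool} (first : ∀ ax ay → G ax ay fzero x₀) where

  followedBelow-∷ : ∀ {ax ay l} → FollowedBelow (shift G x₀ y₀) ax ay l →
    FollowedBelow G (x₀ ∷ᶠ ax) (y₀ ∷ᶠ ay) (suc l)
  followedBelow-∷ _  fzero    _              = first _ _
  followedBelow-∷ fb (fsuc j) (ℕ.s≤s j<l) = fb j j<l

  shift-responsive : Responsive G → Responsive (shift G x₀ y₀)
  shift-responsive responsive ax ay i fb =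
    responsive (x₀ ∷ᶠ ax) (y₀ ∷ᶠ ay) (fsuc i) (followedBelow-∷ fb)

  shift-causal : Causal G → Causal (shift G x₀ y₀)
  shift-causal causal {ax} {ay} {ax'} {ay'} i fb agree =
    causal (fsuc i) (followedBelow-∷ fb) agree-∷
    where
    agree-∷ : ∀ j → toℕ j ℕ.< suc (toℕ i) →
      (x₀ ∷ᶠ ax) j ≡ (x₀ ∷ᶠ ax') j × (y₀ ∷ᶠ ay) j ≡ (y₀ ∷ᶠ ay') j
    agree-∷ fzero    _             = refl , refl
    agree-∷ (fsuc j) (ℕ.s≤s j<i) = agree j j<i

-- The move allowed at x₁ cannot depend on the play, so the universal player answers it by a y₁
-- keeping the rest of the formula false, and recurses.
QEval-false⇒defeating-play : ∀ k (f : (Fin k → Bool) → (Fin k → Bool) → Bool) → QEval k f ≡ false →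
  ∀ G → Responsive G → Causal G →
  ¬ ¬ ∃₂ λ ax ay → f ax ay ≡ false × FollowedBelow G ax ay k
QEval-false⇒defeating-play zero f f-false G _ _ = pure ([]ᶠ , []ᶠ , f-false , λ ())
QEval-false⇒defeating-play (suc k) f f-false G responsive causal = do
  x₀ , g₀ ← responsive (λ _ → false) (λ _ → false) fzero (λ _ ())
  let first : ∀ ax ay → G ax ay fzero x₀
      first ax ay = causal fzero (λ _ ()) (λ _ ()) g₀
  let y₀ , rest-false = QEval-false⇒∀∃-false f f-false x₀
  ax , ay , f≡false , fb ← QEval-false⇒defeating-play k _ rest-false (shift G x₀ y₀)
                             (shift-responsive first responsive) (shift-causal first causal)
  pure (x₀ ∷ᶠ ax , y₀ ∷ᶠ ay , f≡false , followedBelow-∷ {G = G} first fb)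

module History (R : RealField) (Γ : CSTN R)
  (unconditional : ∀ s Z → InT R Γ s Z)
  (props : List (CSTN.Prop Γ)) (∈-props : ∀ p → p ∈ props)
  (σ : Strategy R Γ) (dynamic : Dynamic R Γ σ) where
  open RealField R
  open CSTN Γ
  open OrderedFieldProperties R

  AgreeBefore : Carrier → Scenario Prop → Scenario Prop → Set
  AgreeBefore t s s' = ∀ p → σ s (O p) < t → s p ≡ s' p

  HistEq-sym : ∀ {t s s'} → HistEq R Γ t s s' σ → HistEq R Γ t s' s σ
  HistEq-sym he p = let to , from , agree = he p in from , to , λ h → sym (agree (from h))

  HistEq⇒AgreeBefore : ∀ {t s s'} → HistEq R Γ t s s' σ → AgreeBefore t s s'
  HistEq⇒AgreeBefore he p σsp<t = proj₂ (proj₂ (he p)) (unconditional _ _ , σsp<t)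

  agreeBefore-mono : ∀ {u t s s'} → u ≤ t → AgreeBefore t s s' → AgreeBefore u s s'
  agreeBefore-mono u≤t agree p σsp<u = agree p (<-≤-trans σsp<u u≤t)

  private
    module _ (s s' : Scenario Prop) where
      time : Prop × Bool → Carrier
      time (p , b) = σ (if b then s else s') (O p)

      Discrepant : Prop × Bool → Set
      Discrepant (p , _) = σ s (O p) ≢ σ s' (O p)

      NoDiscrepancyBefore : Carrier → Set
      NoDiscrepancyBefore v = ∀ e → time e < v → ¬ Discrepant e

    events : List (Prop × Bool)
    events = cartesianProduct props (true ∷ false ∷ [])

    ∈-events : ∀ e → e ∈ events
    ∈-events (p , true)  = ∈-cartesianProduct⁺ (∈-props p) (here refl)
    ∈-events (p , false) = ∈-cartesianProduct⁺ (∈-props p) (there (here refl))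

    histEq-below : ∀ {v t s s'} → v ≤ t → AgreeBefore t s s' →
      ¬ ¬ NoDiscrepancyBefore s s' v → HistEq R Γ v s s' σ
    histEq-below v≤t agree ¬¬none p =
        (λ (_ , σsp<v) → unconditional _ _ ,
           <-respˡ-¬¬≡ σsp<v (λ ≢ → ¬¬none (λ none → none (p , true) σsp<v ≢)))
      , (λ (_ , σs'p<v) → unconditional _ _ ,
           <-respˡ-¬¬≡ σs'p<v (λ ≢ → ¬¬none (λ none → none (p , false) σs'p<v (≢ ∘ sym))))
      , (λ (_ , σsp<v) → agreeBefore-mono v≤t agree p σsp<v)

  -- At the earliest discrepant observation both scenarios have the same history, so dynamicity
  -- forces the observation times to coincide after all.
  agreeBefore⇒HistEq : ∀ {t s s'} → AgreeBefore t s s' → HistEq R Γ t s s' σ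
  agreeBefore⇒HistEq {t} {s} {s'} agree =
    histEq-below ≤-refl agree
      (¬¬-map resolve (¬¬-none⊎minimum totalPreorder (time s s') Early events))
    where
    Early : Prop × Bool → Set
    Early e = time s s' e < t × Discrepant s s' e

    earliest-is-not-discrepant : ∀ e₀ → time s s' e₀ < t →
      (∀ e → e ∈ events → Early e → time s s' e₀ ≤ time s s' e) → ¬ Discrepant s s' e₀
    earliest-is-not-discrepant (p₀ , b) e₀<t minimal d₀ =
      d₀ (coincide b (histEq-below (proj₁ e₀<t) agree (pure no-earlier)))
      where
      no-earlier : NoDiscrepancyBefore s s' (time s s' (p₀ , b))
      no-earlier e e<e₀ d = <⇒≱ e<e₀ (minimal e (∈-events e) (<-trans e<e₀ e₀<t , d))

      coincide : ∀ b → HistEq R Γ (time s s' (p₀ , b)) s s' σ → σ s (O p₀) ≡ σ s' (O p₀)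
      coincide true  he = sym (proj₂ (dynamic s s' (O p₀) (unconditional _ _) he))
      coincide false he = proj₂ (dynamic s' s (O p₀) (unconditional _ _) (HistEq-sym he))

    resolve : NoneOrMinimum totalPreorder (time s s') Early events →
      NoDiscrepancyBefore s s' t
    resolve (inj₁ none) e e<t d = none e (∈-events e) (e<t , d)
    resolve (inj₂ (e₀ , (e₀<t , d₀) , minimal)) _ _ _ =
      earliest-is-not-discrepant e₀ e₀<t minimal d₀

  agreeBefore-sym : ∀ {t s s'} → AgreeBefore t s s' → AgreeBefore t s' s
  agreeBefore-sym = HistEq⇒AgreeBefore ∘ HistEq-sym ∘ agreeBefore⇒HistEq

  agreeBefore⇒same-time : ∀ {t s s'} → AgreeBefore t s s' → ∀ Z → σ s Z ≤ t → σ s' Z ≡ σ s Z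
  agreeBefore⇒same-time {s = s} {s'} agree Z σsZ≤t =
    proj₂ (dynamic s s' Z (unconditional s Z) (agreeBefore⇒HistEq (agreeBefore-mono σsZ≤t agree)))

module Reduction (R : RealField) (Φ : Q3SAT) where
  open RealField R
  open OrderedFieldProperties R
  open Q3SAT Φ

  Cᵇ : Bool → Fin n → ΓTask n
  Cᵇ false = C0
  Cᵇ true  = C1

  scenario : (Fin n → Bool) → (Fin n → Bool) → Scenario (ΓProp n)
  scenario ax ay (px i)  = ax i
  scenario ax ay (py i)  = ay i
  scenario ax ay (pc0 i) = true
  scenario ax ay (pc1 i) = true

  clearC : Fin n → Scenario (ΓProp n) → Scenario (ΓProp n)
  clearC i s (pc0 j) = if does (j F.≟ i) then false else s (pc0 j)
  clearC i s (pc1 j) = if does (j F.≟ i) then false else s (pc1 j)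
  clearC i s p       = s p

  clearC-c0 : ∀ i s → clearC i s (pc0 i) ≡ false
  clearC-c0 i s = cong (λ b → if b then false else s (pc0 i)) (dec-true (i F.≟ i) refl)

  clearC-c1 : ∀ i s → clearC i s (pc1 i) ≡ false
  clearC-c1 i s = cong (λ b → if b then false else s (pc1 i)) (dec-true (i F.≟ i) refl)

  props : List (ΓProp n)
  props = concatMap (λ i → px i ∷ py i ∷ pc0 i ∷ pc1 i ∷ []) (allFin n)

  ∈-props : ∀ p → p ∈ props
  ∈-props (px i)  = ∈-concatMap-allFin i (here refl)
  ∈-props (py i)  = ∈-concatMap-allFin i (there (here refl))
  ∈-props (pc0 i) = ∈-concatMap-allFin i (there (there (here refl)))
  ∈-props (pc1 i) = ∈-concatMap-allFin i (there (there (there (here refl))))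

  negLit-holds : ∀ {ax ay} l → litVal ax ay l ≡ false →
    scenario ax ay (proj₁ (negLit l)) ≡ proj₂ (negLit l)
  negLit-holds (lit (xv i) true)  e = e
  negLit-holds (lit (xv i) false) e = not-injective e
  negLit-holds (lit (yv i) true)  e = e
  negLit-holds (lit (yv i) false) e = not-injective e

  falsified-label : ∀ {ax ay l₁ l₂ l₃} →
    litVal ax ay l₁ ∨ litVal ax ay l₂ ∨ litVal ax ay l₃ ≡ false →
    scenario ax ay ⊨ (negLit l₁ ∷ negLit l₂ ∷ negLit l₃ ∷ [])
  falsified-label {ax} {ay} {l₁} {l₂} {l₃} e =
    let e₁ , e₂₃ = ∨-≡-false (litVal ax ay l₁) _ e
        e₂ , e₃  = ∨-≡-false (litVal ax ay l₂) _ e₂₃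
    in negLit-holds l₁ e₁ ∷ negLit-holds l₂ e₂ ∷ negLit-holds l₃ e₃ ∷ []

  module WithViable (σ : Strategy R (Γ R Φ)) (viable : Viable R (Γ R Φ) σ) where
    private
      satisfied : ∀ s {c} → c ∈ ΓConstraints R Φ → s ⊨ LConstraint.label c →
        σ s (LConstraint.Y c) - σ s (LConstraint.X c) ≤ LConstraint.δ c
      satisfied s c∈ s⊨ℓ = proj₂ (proj₂ (viable s _ c∈ s⊨ℓ))

      ≤+1 : ∀ {x y} → y ≤ x + 1# → y ≤ x +ℕ 1
      ≤+1 {x} = subst (_ ≤_) (cong (x +_) (sym fromℕ#-1))

      +1≤ : ∀ {x y} → y + 1# ≤ x → y +ℕ 1 ≤ x
      +1≤ {y = y} = subst (_≤ _) (cong (y +_) (sym fromℕ#-1))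

      ∈-round : ∀ {A : Set} {c₀ : A} {f : Fin n → List A} {rest} i {c} → c ∈ f i →
        c ∈ c₀ ∷ concatMap f (allFin n) ++ rest
      ∈-round i = there ∘ ∈-++⁺ˡ ∘ ∈-concatMap-allFin i

    -- ∈-lookup (# k) is the k-th constraint of round i, in the order of ΓConstraints.
    B₀≤A₀ : ∀ s → σ s (B fzero) ≤ σ s (A fzero) +ℕ 0
    B₀≤A₀ s = y-x≤δ⇒y≤x+δ (satisfied s (here refl) [])

    D≤B+1 : ∀ s i → s (pc0 i) ≡ true → s (pc1 i) ≡ true → σ s (D i) ≤ σ s (B (inject₁ i)) +ℕ 1
    D≤B+1 s i c₀ c₁ = ≤+1 (y-x≤δ⇒y≤x+δ (satisfied s (∈-round i (∈-lookup (# 0))) (c₀ ∷ c₁ ∷ [])))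

    A+n+2≤D : ∀ s i → s (pc0 i) ≡ false → s (pc1 i) ≡ false →
      σ s (A (inject₁ i)) +ℕ (2 ℕ.+ n) ≤ σ s (D i)
    A+n+2≤D s i c₀ c₁ = y-x≤-δ⇒y+δ≤x (satisfied s (∈-round i (∈-lookup (# 1))) (c₀ ∷ c₁ ∷ []))

    A+n+2≤X : ∀ s i → σ s (A (inject₁ i)) +ℕ (2 ℕ.+ n) ≤ σ s (X i)
    A+n+2≤X s i = y-x≤-δ⇒y+δ≤x (satisfied s (∈-round i (∈-lookup (# 2))) [])

    X+1≤Y : ∀ s i → σ s (X i) +ℕ 1 ≤ σ s (Y i)
    X+1≤Y s i = +1≤ (y-x≤-δ⇒y+δ≤x (satisfied s (∈-round i (∈-lookup (# 3))) []))

    Y+1≤A : ∀ s i → σ s (Y i) +ℕ 1 ≤ σ s (A (fsuc i))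
    Y+1≤A s i = +1≤ (y-x≤-δ⇒y+δ≤x (satisfied s (∈-round i (∈-lookup (# 4))) []))

    B≤C+n+4 : ∀ s i → σ s (B (fsuc i)) ≤ σ s (Cᵇ (s (px i)) i) +ℕ (4 ℕ.+ n)
    B≤C+n+4 s i with s (px i) in x≡
    ... | false = y-x≤δ⇒y≤x+δ (satisfied s (∈-round i (∈-lookup (# 5))) (x≡ ∷ []))
    ... | true  = y-x≤δ⇒y≤x+δ (satisfied s (∈-round i (∈-lookup (# 6))) (x≡ ∷ []))

    A+n+1≤B : ∀ s j →
      s ⊨ (negLit (proj₁ (clause j)) ∷ negLit (proj₁ (proj₂ (clause j)))
             ∷ negLit (proj₂ (proj₂ (clause j))) ∷ []) →
      σ s (A (fromℕ n)) +ℕ (1 ℕ.+ n) ≤ σ s (B (fromℕ n))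
    A+n+1≤B s j s⊨ℓ = y-x≤-δ⇒y+δ≤x (satisfied s (there (∈-++⁺ʳ _ (∈-map⁺ _ (∈-allFin j)))) s⊨ℓ)

  module WithStrategy (σ : Strategy R (Γ R Φ)) (viable : Viable R (Γ R Φ) σ)
                      (dynamic : Dynamic R (Γ R Φ) σ) where
    open WithViable σ viable
    open History R (Γ R Φ) (λ _ _ → []) props ∈-props σ dynamic

    -- σ has fixed x_i = b in the play (ax, ay): it executes C_i^b before D_i.
    Commits : (Fin n → Bool) → (Fin n → Bool) → Fin n → Bool → Set
    Commits ax ay i b = σ (scenario ax ay) (Cᵇ b i) < σ (scenario ax ay) (D i)

    X≤Y : ∀ s i → σ s (X i) ≤ σ s (Y i)
    X≤Y s i = ≤-trans (x≤x+ℕk _ 1) (X+1≤Y s i)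

    A-advance : ∀ s i → σ s (A (inject₁ i)) +ℕ (4 ℕ.+ n) ≤ σ s (A (fsuc i))
    A-advance s i = begin
      σ s (A (inject₁ i)) +ℕ (4 ℕ.+ n)            ≡⟨ +ℕ-suc _ (3 ℕ.+ n) ⟨
      σ s (A (inject₁ i)) +ℕ (3 ℕ.+ n) +ℕ 1       ≡⟨ cong (_+ℕ 1) (+ℕ-suc _ (2 ℕ.+ n)) ⟨
      σ s (A (inject₁ i)) +ℕ (2 ℕ.+ n) +ℕ 1 +ℕ 1  ≤⟨ +ℕ-monoˡ-≤ 1 (+ℕ-monoˡ-≤ 1 (A+n+2≤X s i)) ⟩
      σ s (X i) +ℕ 1 +ℕ 1                          ≤⟨ +ℕ-monoˡ-≤ 1 (X+1≤Y s i) ⟩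
      σ s (Y i) +ℕ 1                               ≤⟨ Y+1≤A s i ⟩
      σ s (A (fsuc i))                             ∎
      where open ≤-Reasoning

    A-mono : ∀ s {i j} → i F.≤ j → σ s (A i) ≤ σ s (A j)
    A-mono s {i} = <-weakInduction-startingFrom (λ j → σ s (A i) ≤ σ s (A j)) ≤-refl
      (λ j Ai≤Aj → ≤-trans Ai≤Aj (≤-trans (x≤x+ℕk _ (4 ℕ.+ n)) (A-advance s j)))

    X-mono : ∀ s {i j} → i F.< j → σ s (X i) ≤ σ s (X j)
    X-mono s {i} {j} i<j = begin
      σ s (X i)              ≤⟨ X≤Y s i ⟩
      σ s (Y i)              ≤⟨ x≤x+ℕk _ 1 ⟩
      σ s (Y i) +ℕ 1         ≤⟨ Y+1≤A s i ⟩
      σ s (A (fsuc i))       ≤⟨ A-mono s (subst (suc (toℕ i) ℕ.≤_) (sym (toℕ-inject₁ j)) i<j) ⟩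
      σ s (A (inject₁ j))    ≤⟨ x≤x+ℕk _ (2 ℕ.+ n) ⟩
      σ s (A (inject₁ j)) +ℕ (2 ℕ.+ n) ≤⟨ A+n+2≤X s j ⟩
      σ s (X j)              ∎
      where open ≤-Reasoning

    Gap : (Fin n → Bool) → (Fin n → Bool) → Fin (suc n) → ℕ → Set
    Gap ax ay j k = σ (scenario ax ay) (B j) ≤ σ (scenario ax ay) (A j) +ℕ k

    gap-step : ∀ ax ay i k → Commits ax ay i (ax i) →
      Gap ax ay (inject₁ i) k → Gap ax ay (fsuc i) (suc k)
    gap-step ax ay i k C<D Bᵢ≤Aᵢ+k = begin
      σ s (B (fsuc i))                               ≤⟨ B≤C+n+4 s i ⟩
      σ s (Cᵇ (ax i) i) +ℕ (4 ℕ.+ n)                 ≤⟨ +ℕ-monoˡ-≤ (4 ℕ.+ n) (proj₁ C<D) ⟩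
      σ s (D i) +ℕ (4 ℕ.+ n)                         ≤⟨ +ℕ-monoˡ-≤ (4 ℕ.+ n) (D≤B+1 s i refl refl) ⟩
      σ s (B (inject₁ i)) +ℕ 1 +ℕ (4 ℕ.+ n)          ≤⟨ +ℕ-monoˡ-≤ (4 ℕ.+ n) (+ℕ-monoˡ-≤ 1 Bᵢ≤Aᵢ+k) ⟩
      σ s (A (inject₁ i)) +ℕ k +ℕ 1 +ℕ (4 ℕ.+ n)     ≡⟨ cong (_+ℕ (4 ℕ.+ n)) (+ℕ-suc _ k) ⟩
      σ s (A (inject₁ i)) +ℕ suc k +ℕ (4 ℕ.+ n)      ≡⟨ +ℕ-swap _ (suc k) (4 ℕ.+ n) ⟩
      σ s (A (inject₁ i)) +ℕ (4 ℕ.+ n) +ℕ suc k      ≤⟨ +ℕ-monoˡ-≤ (suc k) (A-advance s i) ⟩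
      σ s (A (fsuc i)) +ℕ suc k                      ∎
      where
      s = scenario ax ay
      open ≤-Reasoning

    gap : ∀ ax ay j {l} → toℕ j ≡ l → FollowedBelow Commits ax ay l → Gap ax ay j l
    gap ax ay j refl = <-weakInduction P (λ _ → B₀≤A₀ (scenario ax ay)) step j
      where
      P : Fin (suc n) → Set
      P j = FollowedBelow Commits ax ay (toℕ j) → Gap ax ay j (toℕ j)

      step : ∀ i → P (inject₁ i) → P (fsuc i)
      step i gapᵢ fb = gap-step ax ay i (toℕ i) (fb i (ℕ.n<1+n (toℕ i)))
        (subst (Gap ax ay (inject₁ i)) (toℕ-inject₁ i)
               (gapᵢ (followedBelow-mono {G = Commits} toℕ-inject₁-i≤1+i fb)))
        where
        toℕ-inject₁-i≤1+i : toℕ (inject₁ i) ℕ.≤ suc (toℕ i)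
        toℕ-inject₁-i≤1+i = ℕ.m≤n⇒m≤1+n (ℕ.≤-reflexive (toℕ-inject₁ i))

    D-before-deadline : ∀ ax ay i → FollowedBelow Commits ax ay (toℕ i) →
      σ (scenario ax ay) (D i) < σ (scenario ax ay) (A (inject₁ i)) +ℕ (2 ℕ.+ n)
    D-before-deadline ax ay i fb = begin-strict
      σ s (D i)                             ≤⟨ D≤B+1 s i refl refl ⟩
      σ s (B (inject₁ i)) +ℕ 1              ≤⟨ +ℕ-monoˡ-≤ 1 (gap ax ay (inject₁ i) (toℕ-inject₁ i) fb) ⟩
      σ s (A (inject₁ i)) +ℕ toℕ i +ℕ 1     ≡⟨ +ℕ-suc _ (toℕ i) ⟩
      σ s (A (inject₁ i)) +ℕ suc (toℕ i)    <⟨ +ℕ-monoʳ-< _ (ℕ.m<n⇒m<1+n (ℕ.s≤s (toℕ<n i))) ⟩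
      σ s (A (inject₁ i)) +ℕ (2 ℕ.+ n)      ∎
      where
      s = scenario ax ay
      open ≤-Reasoning

    -- Executing neither C_i^0 nor C_i^1 before D_i, σ cannot tell the play from the scenario in
    -- which both c_i are false, where D_i has to wait until A_i + n + 2.
    some-C-before-D : Responsive Commits
    some-C-before-D ax ay i fb no-commitment = <-irrefl refl (begin-strict
      t                                 <⟨ D-before-deadline ax ay i fb ⟩
      σ s (A (inject₁ i)) +ℕ (2 ℕ.+ n)  ≡⟨ cong (_+ℕ (2 ℕ.+ n)) A≡A' ⟩
      σ s' (A (inject₁ i)) +ℕ (2 ℕ.+ n) ≤⟨ A'+n+2≤t ⟩
      t                                 ∎)
      where
      open ≤-Reasoning
      s = scenario ax ay
      s' = clearC i s
      t = σ s (D i)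

      agree : AgreeBefore t s s'
      agree (px j)  _ = refl
      agree (py j)  _ = refl
      agree (pc0 j) C⁰<D with j F.≟ i
      ... | yes refl = ⊥-elim (no-commitment (false , C⁰<D))
      ... | no _     = refl
      agree (pc1 j) C¹<D with j F.≟ i
      ... | yes refl = ⊥-elim (no-commitment (true , C¹<D))
      ... | no _     = refl

      A'+n+2≤t : σ s' (A (inject₁ i)) +ℕ (2 ℕ.+ n) ≤ t
      A'+n+2≤t = subst (σ s' (A (inject₁ i)) +ℕ (2 ℕ.+ n) ≤_)
        (agreeBefore⇒same-time agree (D i) ≤-refl) (A+n+2≤D s' i (clearC-c0 i s) (clearC-c1 i s))

      A≡A' : σ s (A (inject₁ i)) ≡ σ s' (A (inject₁ i))
      A≡A' = agreeBefore⇒same-time (agreeBefore-sym agree) (A (inject₁ i))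
        (≤-trans (x≤x+ℕk _ (2 ℕ.+ n)) A'+n+2≤t)

    -- Everything σ observes before X_i concerns x_j, y_j with j < i.
    commits-causal : Causal Commits
    commits-causal {ax} {ay} {ax'} {ay'} i {b} fb same C<D =
      subst₂ _<_ (sym (same-time (Cᵇ b i) (≤-trans (proj₁ C<D) (proj₁ D<X))))
                 (sym (same-time (D i) (proj₁ D<X))) C<D
      where
      s = scenario ax ay
      s' = scenario ax' ay'

      D<X : σ s (D i) < σ s (X i)
      D<X = <-≤-trans (D-before-deadline ax ay i fb) (A+n+2≤X s i)

      agree : AgreeBefore (σ s (X i)) s s'
      agree (px j) Xⱼ<Xᵢ with <-cmp j i
      ... | tri< j<i _ _  = proj₁ (same j j<i)
      ... | tri≈ _ refl _ = ⊥-elim (<-irrefl refl Xⱼ<Xᵢ)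
      ... | tri> _ _ i<j  = ⊥-elim (<⇒≱ Xⱼ<Xᵢ (X-mono s i<j))
      agree (py j) Yⱼ<Xᵢ with <-cmp j i
      ... | tri< j<i _ _  = proj₂ (same j j<i)
      ... | tri≈ _ refl _ = ⊥-elim (<⇒≱ Yⱼ<Xᵢ (X≤Y s i))
      ... | tri> _ _ i<j  = ⊥-elim (<⇒≱ Yⱼ<Xᵢ (≤-trans (X-mono s i<j) (X≤Y s j)))
      agree (pc0 j) _ = refl
      agree (pc1 j) _ = refl

      same-time : ∀ Z → σ s Z ≤ σ s (X i) → σ s' Z ≡ σ s Z
      same-time = agreeBefore⇒same-time agree

    no-falsifying-play : ¬ ∃₂ λ ax ay → matrix Φ ax ay ≡ false × FollowedBelow Commits ax ay n
    no-falsifying-play (ax , ay , falsified , fb) with foldr-∧-false _ (allFin m) falsified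
    ... | j , clause-false = <-irrefl refl (begin-strict
      σ s (B (fromℕ n))                ≤⟨ gap ax ay (fromℕ n) (toℕ-fromℕ n) fb ⟩
      σ s (A (fromℕ n)) +ℕ n           <⟨ +ℕ-monoʳ-< _ (ℕ.n<1+n n) ⟩
      σ s (A (fromℕ n)) +ℕ (1 ℕ.+ n)   ≤⟨ A+n+1≤B s j (falsified-label clause-false) ⟩
      σ s (B (fromℕ n))                ∎)
      where
      s = scenario ax ay
      open ≤-Reasoning

lemma21 : (R : RealField) (Φ : Q3SAT) → truth Φ ≡ false →
          ¬ DynamicallyControllable R (Γ R Φ)
lemma21 R Φ Φ-false (σ , viable , dynamic) =
  QEval-false⇒defeating-play (Q3SAT.n Φ) (matrix Φ) Φ-false
    Commits some-C-before-D commits-causal no-falsifying-play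
  where open Reduction.WithStrategy R Φ σ viable dynamic
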